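{- Let $H_1\in\mathcal{H}$ and let $T\in\mathcal{H}$ be a tree. If $H_1\le T$, then $H_1$ is a tree.
   Context: All graphs are finite and simple, considered up to isomorphism. An edge-colored graph is a pair $(G,c)$ with $c\colon E(G)\to\mathbb{N}$ an arbitrary map (not necessarily proper); it is colored in $t$ or more colors if $|c(E(G))|\ge t$. A subgraph (not necessarily induced) is rainbow if its edges receive pairwise distinct colors. $(G,c)$ is rainbow $H$-free if $G$ contains no rainbow subgraph isomorphic to $H$. For graphs $H_1,H_2$, write $H_1\le H_2$ if there is a positive integer $t$ such that every rainbow $H_1$-free edge-colored complete graph colored in $t$ or more colors is rainbow $H_2$-free. $\mathcal{H}$ denotes the set of connected finite simple graphs other than the paths $P_1,P_2,P_3,P_4$ ($P_k$ is the path on $k$ vertices). -}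

module Defs where

open import Data.Nat using (ℕ; zero; suc; _≤_; _+_)
open import Data.Fin using (Fin; toℕ)
open import Data.Bool using (Bool; true; false; _∨_)
open import Data.Bool.Properties using (∨-comm)
open import Data.Nat using (_≡ᵇ_)
open import Data.Product using (Σ; ∃; _×_; _,_)
open import Data.Sum using (_⊎_)
open import Data.Empty using (⊥)
open import Relation.Nullary using (¬_)
open import Relation.Binary.PropositionalEquality using (_≡_; _≢_; refl; cong₂)
open import Function.Definitions using (Injective)

record Graph : Set where
  field
    n     : ℕ
    adj   : Fin n → Fin n → Bool
    sym   : ∀ u v → adj u v ≡ adj v u
    irrefl : ∀ u → adj u u ≡ false
open Graph public

Adj : (G : Graph) → Fin (n G) → Fin (n G) → Set
Adj G u v = adj G u v ≡ true

record Iso (G H : Graph) : Set where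
  field
    to    : Fin (n G) → Fin (n H)
    from  : Fin (n H) → Fin (n G)
    from-to : ∀ u → from (to u) ≡ u
    to-from : ∀ v → to (from v) ≡ v
    preserves : ∀ u v → adj H (to u) (to v) ≡ adj G u v

data Reach (G : Graph) : Fin (n G) → Fin (n G) → Set where
  here : ∀ {u} → Reach G u u
  step : ∀ {u w v} → Adj G u w → Reach G w v → Reach G u v

Connected : Graph → Set
Connected G = (1 ≤ n G) × (∀ u v → Reach G u v)

record Cycle (G : Graph) : Set where
  field
    len    : ℕ
    len≥3  : 3 ≤ len
    vtx    : Fin len → Fin (n G)
    inj    : Injective _≡_ _≡_ vtx
    consec : ∀ (i j : Fin len) → suc (toℕ i) ≡ toℕ j → Adj G (vtx i) (vtx j)
    close  : ∀ (i j : Fin len) → suc (toℕ i) ≡ len → toℕ j ≡ 0 → Adj G (vtx i) (vtx j)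

Acyclic : Graph → Set
Acyclic G = ¬ Cycle G

Tree : Graph → Set
Tree G = Connected G × Acyclic G

pathAdj : ∀ {k} → Fin k → Fin k → Bool
pathAdj i j = (suc (toℕ i) ≡ᵇ toℕ j) ∨ (suc (toℕ j) ≡ᵇ toℕ i)

private
  suc≠ : ∀ m → (suc m ≡ᵇ m) ≡ false
  suc≠ zero = refl
  suc≠ (suc m) = suc≠ m

P : ℕ → Graph
P k = record
  { n = k
  ; adj = pathAdj
  ; sym = λ u v → ∨-comm (suc (toℕ u) ≡ᵇ toℕ v) (suc (toℕ v) ≡ᵇ toℕ u)
  ; irrefl = λ u → cong₂ _∨_ (suc≠ (toℕ u)) (suc≠ (toℕ u))
  }

InH : Graph → Set
InH G = Connected G × (¬ Iso G (P 1)) × (¬ Iso G (P 2)) × (¬ Iso G (P 3)) × (¬ Iso G (P 4))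

-- Edge-colourings of the complete graph K_m: a symmetric map on pairs
-- (the diagonal values are irrelevant; only pairs i ≠ j are edges).
SymColouring : (m : ℕ) → (Fin m → Fin m → ℕ) → Set
SymColouring m c = ∀ i j → c i j ≡ c j i

AtLeastColours : (m t : ℕ) → (Fin m → Fin m → ℕ) → Set
AtLeastColours m t c =
  Σ (Fin t → Fin m) λ a → Σ (Fin t → Fin m) λ b →
    (∀ k → a k ≢ b k) × (∀ k l → c (a k) (b k) ≡ c (a l) (b l) → k ≡ l)

SamePair : ∀ {A : Set} → A → A → A → A → Set
SamePair u v u' v' = (u ≡ u' × v ≡ v') ⊎ (u ≡ v' × v ≡ u')

-- (K_m, c) contains a rainbow copy of H (not necessarily induced): an
-- injective vertex map such that distinct edges of H get distinct colours.
HasRainbow : (H : Graph) (m : ℕ) → (Fin m → Fin m → ℕ) → Set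
HasRainbow H m c =
  Σ (Fin (n H) → Fin m) λ φ → Injective _≡_ _≡_ φ ×
    (∀ u v u' v' → Adj H u v → Adj H u' v' → ¬ SamePair u v u' v' →
       c (φ u) (φ v) ≢ c (φ u') (φ v'))

RainbowFree : (H : Graph) (m : ℕ) → (Fin m → Fin m → ℕ) → Set
RainbowFree H m c = ¬ HasRainbow H m c

_≼_ : Graph → Graph → Set
H₁ ≼ H₂ = Σ ℕ λ t → 1 ≤ t ×
  (∀ m (c : Fin m → Fin m → ℕ) → SymColouring m c → AtLeastColours m t c →
     RainbowFree H₁ m c → RainbowFree H₂ m c)

{-# OPTIONS --safe #-}
module Submission where

-- Colour K_m by c(i, j) = min(i, j); this uses m - 1 colours. On a cycle, the vertex with the
-- least label sees that label on both of its cycle edges, so (K_m, c) contains no rainbow graph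
-- with a cycle. A forest, on the other hand, has a vertex of degree at most one; ranking it lowest
-- and recursing gives a ranking in which every vertex has at most one higher-ranked neighbour.
-- Embedding the forest into K_m by rank colours each edge by the rank of its lower end, which
-- determines the edge, so the copy is rainbow. Hence H₁ ≤ T forces H₁ to be acyclic.

open import Defs
open import Data.Bool using (true)
import Data.Bool.Properties as Bool
open import Data.Empty using (⊥-elim)
open import Data.Fin using (Fin; zero; suc; toℕ; fromℕ; fromℕ<; inject₁; inject≤; punchIn; punchOut)
  renaming (_<_ to _<ᶠ_)
open import Data.Fin.Permutation using (Permutation′; _⟨$⟩ʳ_; insert; insert-punchIn)
  renaming (id to idₚ)
open import Data.Fin.Properties
  using (toℕ-injective; toℕ-inject₁; toℕ-inject≤; toℕ-fromℕ; toℕ<n; ≤̄⇒inject₁<; <⇒≢; <-cmp;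
         punchIn-injective; punchIn-punchOut; inject≤-injective; injective⇒≤; any?; _≟_)
open import Data.Fin.Relation.Unary.Top using (view; ‵fromℕ; ‵inject₁)
open import Data.List using (allFin)
open import Data.List.Extrema.Nat using (argmin; f[argmin]≤f[xs])
open import Data.List.Membership.Propositional.Properties using (∈-allFin)
import Data.List.Relation.Unary.All as All
open import Data.Nat using (ℕ; zero; suc; _+_; _⊓_; _≤_; _<_; z≤n; s≤s; s<s⁻¹)
open import Data.Nat.Properties
  using (≤-refl; ≤-trans; <⇒≤; n≤1+n; n≮0; 1+n≰n; m≤m+n; m≤n+m; m≤n⇒m≤1+n; +-suc; +-identityʳ;
         suc-injective; ⊓-comm; m≤n⇒m⊓n≡m; m≥n⇒m⊓n≡n)
open import Data.Product using (∃; ∃₂; _×_; _,_; proj₁; proj₂; swap)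
open import Data.Sum using (_⊎_; inj₁; inj₂)
open import Function using (_∘_; id)
open import Function.Bundles using (Injection)
open import Function.Definitions using (Injective)
open import Function.Properties.Inverse using (↔⇒↣)
open import Relation.Binary.Definitions using (Decidable; tri<; tri≈; tri>)
open import Relation.Binary.PropositionalEquality
  using (_≡_; _≢_; refl; trans; cong; cong₂; subst; subst₂) renaming (sym to ≡-sym)
open import Relation.Nullary using (¬_; Dec; yes; no)
open import Relation.Nullary.Decidable using (_×-dec_; ¬?)

Adj-sym : (G : Graph) {u v : Fin (n G)} → Adj G u v → Adj G v u
Adj-sym G {u} {v} = trans (sym G v u)

Adj-irrefl : (G : Graph) {u : Fin (n G)} → ¬ Adj G u u
Adj-irrefl G {u} e with trans (≡-sym (irrefl G u)) e
... | ()

Adj? : (G : Graph) → Decidable (Adj G)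
Adj? G u v = adj G u v Bool.≟ true

AtMostOneNeighbour : (G : Graph) → Fin (n G) → Set
AtMostOneNeighbour G u = ∀ {v v'} → Adj G u v → Adj G u v' → v ≡ v'

induced : (G : Graph) {k : ℕ} → (Fin k → Fin (n G)) → Graph
induced G {k} ι = record
  { n = k
  ; adj = λ x y → adj G (ι x) (ι y)
  ; sym = λ x y → sym G (ι x) (ι y)
  ; irrefl = λ x → irrefl G (ι x)
  }

induced-acyclic : (G : Graph) {k : ℕ} {ι : Fin k → Fin (n G)} →
                  Injective _≡_ _≡_ ι → Acyclic G → Acyclic (induced G ι)
induced-acyclic G {ι = ι} ι-inj acyclic C = acyclic (record
  { len = len ; len≥3 = len≥3 ; vtx = ι ∘ vtx ; inj = inj ∘ ι-inj
  ; consec = consec ; close = close })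
  where open Cycle C


record Path (G : Graph) (L : ℕ) : Set where
  field
    vtx    : Fin (suc L) → Fin (n G)
    inj    : Injective _≡_ _≡_ vtx
    consec : ∀ i j → suc (toℕ i) ≡ toℕ j → Adj G (vtx i) (vtx j)

module _ {G : Graph} where

  trivial-path : Fin (n G) → Path G 0
  trivial-path v = record
    { vtx = λ _ → v
    ; inj = λ { {zero} {zero} _ → refl }
    ; consec = λ { zero zero () }
    }

  module _ {L : ℕ} (P : Path G L) where
    open Path P

    OnPath : Fin (n G) → Set
    OnPath w = ∃ λ i → vtx i ≡ w

    onPath? : ∀ w → Dec (OnPath w)
    onPath? w = any? (λ i → vtx i ≟ w)

    path-length< : L < n G
    path-length< = injective⇒≤ inj

    prepend : (w : Fin (n G)) → Adj G w (vtx zero) → ¬ OnPath w → Path G (suc L)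
    prepend w e w∉P = record { vtx = vtx′ ; inj = inj′ ; consec = consec′ }
      where
        vtx′ : Fin (suc (suc L)) → Fin (n G)
        vtx′ zero    = w
        vtx′ (suc i) = vtx i
        inj′ : Injective _≡_ _≡_ vtx′
        inj′ {zero}  {zero}  _  = refl
        inj′ {zero}  {suc j} eq = ⊥-elim (w∉P (j , ≡-sym eq))
        inj′ {suc i} {zero}  eq = ⊥-elim (w∉P (i , eq))
        inj′ {suc i} {suc j} eq = cong suc (inj eq)
        consec′ : ∀ i j → suc (toℕ i) ≡ toℕ j → Adj G (vtx′ i) (vtx′ j)
        consec′ zero    (suc zero) _  = e
        consec′ (suc i) (suc j)    eq = consec i j (suc-injective eq)

    chord⇒cycle : (j : Fin (suc L)) → 2 ≤ toℕ j → Adj G (vtx zero) (vtx j) → Cycle G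
    chord⇒cycle j 2≤j chord = record
      { len = suc (toℕ j)
      ; len≥3 = s≤s 2≤j
      ; vtx = vtx ∘ ι
      ; inj = λ {a} {b} eq → inject≤-injective _ _ a b (inj eq)
      ; consec = λ a b eq →
          consec (ι a) (ι b) (trans (cong suc (toℕ-ι a)) (trans eq (≡-sym (toℕ-ι b))))
      ; close = λ a b a-last b-first →
          subst₂ (λ x y → Adj G (vtx x) (vtx y))
            (≡-sym (toℕ-injective (trans (toℕ-ι a) (suc-injective a-last))))
            (≡-sym (toℕ-injective {j = zero} (trans (toℕ-ι b) b-first)))
            (Adj-sym G chord)
      }
      where
        ι : Fin (suc (toℕ j)) → Fin (suc L)
        ι k = inject≤ k (toℕ<n j)
        toℕ-ι : ∀ k → toℕ (ι k) ≡ toℕ k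
        toℕ-ι k = toℕ-inject≤ k (toℕ<n j)

    -- a neighbour of the start further along the path would close a cycle
    maximal-path-start : Acyclic G → (∀ {w} → Adj G (vtx zero) w → OnPath w) →
                         AtMostOneNeighbour G (vtx zero)
    maximal-path-start acyclic maximal e e' with maximal e | maximal e'
    ... | i , refl | i' , refl =
      cong vtx (toℕ-injective (trans (index≡1 i e) (≡-sym (index≡1 i' e'))))
      where
        index≡1 : ∀ i → Adj G (vtx zero) (vtx i) → toℕ i ≡ 1
        index≡1 zero          e = ⊥-elim (Adj-irrefl G e)
        index≡1 (suc zero)    _ = refl
        index≡1 (suc (suc i)) e = ⊥-elim (acyclic (chord⇒cycle (suc (suc i)) (s≤s (s≤s z≤n)) e))

  acyclic⇒atMostOneNeighbour : Acyclic G → Fin (n G) → ∃ (AtMostOneNeighbour G)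
  acyclic⇒atMostOneNeighbour acyclic v = grow (n G) (trivial-path v) ≤-refl
    where
      grow : ∀ {L} fuel → Path G L → n G ≤ L + fuel → ∃ (AtMostOneNeighbour G)
      grow {L} zero P bound =
        ⊥-elim (1+n≰n (≤-trans (path-length< P) (subst (n G ≤_) (+-identityʳ L) bound)))
      grow {L} (suc fuel) P bound
        with any? (λ w → Adj? G (Path.vtx P zero) w ×-dec ¬? (onPath? P w))
      ... | yes (w , e , w∉P) =
        grow fuel (prepend P w (Adj-sym G e) w∉P) (subst (n G ≤_) (+-suc L fuel) bound)
      ... | no no-exit = Path.vtx P zero , maximal-path-start P acyclic maximal
        where
          maximal : ∀ {w} → Adj G (Path.vtx P zero) w → OnPath P w
          maximal {w} e with onPath? P w
          ... | yes w∈P = w∈P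
          ... | no  w∉P = ⊥-elim (no-exit (w , e , w∉P))


record OneDegenerateRanking (G : Graph) : Set where
  field
    rank : Permutation′ (n G)
    upward-unique : ∀ {u v v'} → Adj G u v → Adj G u v' →
                    rank ⟨$⟩ʳ u <ᶠ rank ⟨$⟩ʳ v → rank ⟨$⟩ʳ u <ᶠ rank ⟨$⟩ʳ v' → v ≡ v'

data PunchInView {k : ℕ} (ℓ : Fin (suc k)) : Fin (suc k) → Set where
  self    : PunchInView ℓ ℓ
  punched : (x : Fin k) → PunchInView ℓ (punchIn ℓ x)

punchInView : ∀ {k} (ℓ u : Fin (suc k)) → PunchInView ℓ u
punchInView ℓ u with ℓ ≟ u
... | yes refl = self
... | no  ℓ≢u  = subst (PunchInView ℓ) (punchIn-punchOut ℓ≢u) (punched (punchOut ℓ≢u))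

insert-self : ∀ {k} (i j : Fin (suc k)) (π : Permutation′ k) → insert i j π ⟨$⟩ʳ i ≡ j
insert-self i j π with i ≟ i
... | yes _   = refl
... | no  i≢i = ⊥-elim (i≢i refl)

-- Stated for subgraphs induced along injections ι so that deleting a vertex is recursion on k.
induced-ranking : (G : Graph) → Acyclic G → ∀ {k} (ι : Fin k → Fin (n G)) →
                  Injective _≡_ _≡_ ι → OneDegenerateRanking (induced G ι)
induced-ranking G acyclic {zero} ι _ = record { rank = idₚ ; upward-unique = λ { {()} } }
induced-ranking G acyclic {suc k} ι ι-inj = record { rank = rank ; upward-unique = upward-unique }
  where
    H : Graph
    H = induced G ι
    leaf : ∃ (AtMostOneNeighbour H)
    leaf = acyclic⇒atMostOneNeighbour (induced-acyclic G ι-inj acyclic) zero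
    ℓ : Fin (suc k)
    ℓ = proj₁ leaf
    rest : OneDegenerateRanking (induced G (ι ∘ punchIn ℓ))
    rest = induced-ranking G acyclic (ι ∘ punchIn ℓ) (punchIn-injective ℓ _ _ ∘ ι-inj)
    open OneDegenerateRanking rest using () renaming (rank to rank′; upward-unique to upward-unique′)

    rank : Permutation′ (suc k)
    rank = insert ℓ zero rank′

    rank-ℓ : rank ⟨$⟩ʳ ℓ ≡ zero
    rank-ℓ = insert-self ℓ zero rank′

    rank-punchIn : ∀ x → rank ⟨$⟩ʳ punchIn ℓ x ≡ suc (rank′ ⟨$⟩ʳ x)
    rank-punchIn = insert-punchIn ℓ zero rank′

    nothing-below-ℓ : ∀ {u} → ¬ (rank ⟨$⟩ʳ u <ᶠ rank ⟨$⟩ʳ ℓ)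
    nothing-below-ℓ {u} lt = n≮0 (subst (rank ⟨$⟩ʳ u <ᶠ_) rank-ℓ lt)

    unpunch : ∀ {x y} → rank ⟨$⟩ʳ punchIn ℓ x <ᶠ rank ⟨$⟩ʳ punchIn ℓ y →
              rank′ ⟨$⟩ʳ x <ᶠ rank′ ⟨$⟩ʳ y
    unpunch {x} {y} lt = s<s⁻¹ (subst₂ _<ᶠ_ (rank-punchIn x) (rank-punchIn y) lt)

    upward-unique : ∀ {u v v'} → Adj H u v → Adj H u v' →
                    rank ⟨$⟩ʳ u <ᶠ rank ⟨$⟩ʳ v → rank ⟨$⟩ʳ u <ᶠ rank ⟨$⟩ʳ v' → v ≡ v'
    upward-unique {u} {v} {v'} e e' lt lt'
      with punchInView ℓ u | punchInView ℓ v | punchInView ℓ v'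
    ... | self      | _         | _          = proj₂ leaf e e'
    ... | punched _ | self      | _          = ⊥-elim (nothing-below-ℓ lt)
    ... | punched _ | punched _ | self       = ⊥-elim (nothing-below-ℓ lt')
    ... | punched _ | punched _ | punched _  =
      cong (punchIn ℓ) (upward-unique′ e e' (unpunch lt) (unpunch lt'))

acyclic⇒ranking : {G : Graph} → Acyclic G → OneDegenerateRanking G
acyclic⇒ranking {G} acyclic = induced-ranking G acyclic id id


minColouring : ∀ {m} → Fin m → Fin m → ℕ
minColouring i j = toℕ i ⊓ toℕ j

minColouring-sym : ∀ m → SymColouring m minColouring
minColouring-sym m i j = ⊓-comm (toℕ i) (toℕ j)

minColouring-atLeast : ∀ {m t} → t ≤ m → AtLeastColours (suc m) t minColouring
minColouring-atLeast {m} {t} t≤m = inject₁ ∘ ι , suc ∘ ι , (λ l → <⇒≢ (≤̄⇒inject₁< ≤-refl)) ,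
  λ l l' eq → toℕ-injective (trans (≡-sym (colour l)) (trans eq (colour l')))
  where
    ι : Fin t → Fin m
    ι l = inject≤ l t≤m
    colour : ∀ l → minColouring (inject₁ (ι l)) (suc (ι l)) ≡ toℕ l
    colour l = trans (cong₂ _⊓_ (toℕ-inject₁ (ι l)) refl)
                     (trans (m≤n⇒m⊓n≡m (n≤1+n _)) (toℕ-inject≤ l t≤m))

module _ {G : Graph} (R : OneDegenerateRanking G) where
  open OneDegenerateRanking R

  private
    r : Fin (n G) → ℕ
    r u = toℕ (rank ⟨$⟩ʳ u)

    r-injective : ∀ {u v} → r u ≡ r v → u ≡ v
    r-injective = Injection.injective (↔⇒↣ rank) ∘ toℕ-injective

    orient : ∀ {u v} → Adj G u v →
             (rank ⟨$⟩ʳ u <ᶠ rank ⟨$⟩ʳ v × r u ⊓ r v ≡ r u) ⊎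
             (rank ⟨$⟩ʳ v <ᶠ rank ⟨$⟩ʳ u × r u ⊓ r v ≡ r v)
    orient {u} {v} e with <-cmp (rank ⟨$⟩ʳ u) (rank ⟨$⟩ʳ v)
    ... | tri< lt _  _  = inj₁ (lt , m≤n⇒m⊓n≡m (<⇒≤ lt))
    ... | tri≈ _  eq _  =
      ⊥-elim (Adj-irrefl G (subst (Adj G u) (≡-sym (r-injective (cong toℕ eq))) e))
    ... | tri> _  _  gt = inj₂ (gt , m≥n⇒m⊓n≡n (<⇒≤ gt))

    same-lower-end : ∀ {x y x' y'} → Adj G x y → Adj G x' y' →
                     rank ⟨$⟩ʳ x <ᶠ rank ⟨$⟩ʳ y → rank ⟨$⟩ʳ x' <ᶠ rank ⟨$⟩ʳ y' → r x ≡ r x' →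
                     x ≡ x' × y ≡ y'
    same-lower-end e e' lt lt' eq with r-injective eq
    ... | refl = refl , upward-unique e e' lt lt'

  minRank-determines-edge : ∀ {u v u' v'} → Adj G u v → Adj G u' v' →
                            r u ⊓ r v ≡ r u' ⊓ r v' → SamePair u v u' v'
  minRank-determines-edge e e' eq with orient e | orient e'
  ... | inj₁ (lt , min≡) | inj₁ (lt' , min≡') =
    inj₁ (same-lower-end e e' lt lt' (trans (≡-sym min≡) (trans eq min≡')))
  ... | inj₁ (lt , min≡) | inj₂ (lt' , min≡') =
    inj₂ (same-lower-end e (Adj-sym G e') lt lt' (trans (≡-sym min≡) (trans eq min≡')))
  ... | inj₂ (lt , min≡) | inj₁ (lt' , min≡') =
    inj₂ (swap (same-lower-end (Adj-sym G e) e' lt lt' (trans (≡-sym min≡) (trans eq min≡'))))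
  ... | inj₂ (lt , min≡) | inj₂ (lt' , min≡') =
    inj₁ (swap (same-lower-end (Adj-sym G e) (Adj-sym G e') lt lt'
                 (trans (≡-sym min≡) (trans eq min≡'))))

  ranking⇒hasRainbow : ∀ {m} → n G ≤ m → HasRainbow G m minColouring
  ranking⇒hasRainbow n≤m = φ , Injection.injective (↔⇒↣ rank) ∘ inject≤-injective _ _ _ _ ,
    λ u v u' v' e e' ¬same eq →
      ¬same (minRank-determines-edge e e' (trans (≡-sym (colour u v)) (trans eq (colour u' v'))))
    where
      φ : Fin (n G) → Fin _
      φ u = inject≤ (rank ⟨$⟩ʳ u) n≤m
      colour : ∀ u v → minColouring (φ u) (φ v) ≡ r u ⊓ r v
      colour u v = cong₂ _⊓_ (toℕ-inject≤ _ n≤m) (toℕ-inject≤ _ n≤m)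


Consecutive : ∀ {L} → Fin L → Fin L → Set
Consecutive {L} i j = suc (toℕ i) ≡ toℕ j ⊎ (suc (toℕ i) ≡ L × toℕ j ≡ 0)

cycle-adj : {G : Graph} (C : Cycle G) {i j : Fin (Cycle.len C)} →
            Consecutive i j → Adj G (Cycle.vtx C i) (Cycle.vtx C j)
cycle-adj C (inj₁ eq)              = Cycle.consec C _ _ eq
cycle-adj C (inj₂ (i-last , j≡0)) = Cycle.close C _ _ i-last j≡0

cyclic-neighbours : ∀ {L} → 3 ≤ L → (i : Fin L) →
                    ∃₂ λ j k → j ≢ k × Consecutive j i × Consecutive i k
cyclic-neighbours (s≤s (s≤s (s≤s _))) zero =
  fromℕ _ , suc zero , (λ ()) , inj₂ (cong suc (toℕ-fromℕ _) , refl) , inj₁ refl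
cyclic-neighbours (s≤s (s≤s (s≤s _))) (suc i) with view i
... | ‵fromℕ =
  inject₁ (fromℕ _) , zero , (λ ()) , inj₁ (cong suc (toℕ-inject₁ (fromℕ _))) ,
  inj₂ (cong (2 +_) (toℕ-fromℕ _) , refl)
... | ‵inject₁ i′ =
  inject₁ (inject₁ i′) , suc (suc i′) , <⇒≢ (≤̄⇒inject₁< (<⇒≤ (≤̄⇒inject₁< ≤-refl))) ,
  inj₁ (cong suc (toℕ-inject₁ (inject₁ i′))) , inj₁ (cong (2 +_) (toℕ-inject₁ i′))

argmin-Fin : ∀ {L} (f : Fin L → ℕ) → Fin L → ∃ λ i → ∀ j → f i ≤ f j
argmin-Fin f i₀ =
  argmin f i₀ (allFin _) , λ j → All.lookup (f[argmin]≤f[xs] i₀ (allFin _)) (∈-allFin j)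

module _ {H : Graph} (C : Cycle H) where
  open Cycle C

  cycle⇒rainbowFree : ∀ m → RainbowFree H m minColouring
  cycle⇒rainbowFree m (φ , _ , rainbow)
    with argmin-Fin (λ i → toℕ (φ (vtx i))) (fromℕ< (≤-trans (s≤s z≤n) len≥3))
  ... | i , i-min with cyclic-neighbours len≥3 i
  ... | j , k , j≢k , ji , ik =
    rainbow (vtx i) (vtx j) (vtx i) (vtx k)
      (Adj-sym H (cycle-adj C ji)) (cycle-adj C ik) not-same
      (trans (m≤n⇒m⊓n≡m (i-min j)) (≡-sym (m≤n⇒m⊓n≡m (i-min k))))
    where
      not-same : ¬ SamePair (vtx i) (vtx j) (vtx i) (vtx k)
      not-same (inj₁ (_ , vj≡vk))  = j≢k (inj vj≡vk)
      not-same (inj₂ (vi≡vk , _)) =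
        Adj-irrefl H (subst (Adj H (vtx i)) (≡-sym vi≡vk) (cycle-adj C ik))

theorem3 : (H₁ T : Graph) → InH H₁ → InH T → Tree T → H₁ ≼ T → Tree H₁
theorem3 H₁ T (H₁-connected , _) _ (_ , T-acyclic) (t , _ , H₁≼T) = H₁-connected , H₁-acyclic
  where
    m : ℕ
    m = suc (t + n T)
    H₁-acyclic : Acyclic H₁
    H₁-acyclic C =
      H₁≼T m minColouring (minColouring-sym m) (minColouring-atLeast (m≤m+n t (n T)))
        (cycle⇒rainbowFree C m)
        (ranking⇒hasRainbow (acyclic⇒ranking T-acyclic) (m≤n⇒m≤1+n (m≤n+m (n T) t)))
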